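{- Let $\mathcal{B}$ be the monotone grid class with 3 columns and 3 rows whose increasing cells, written as (column, row), are $(1,1),(1,2),(2,1),(3,3)$ and all of whose other cells are empty. Then \[\mathcal{B}=\operatorname{Av}(2143, 4321, 35142, 35214, 35241, 43152, 53142).\]
   Context: Pattern containment: $\pi$ contains $\sigma$ if some subsequence of $\pi$ is order-isomorphic to $\sigma$; $\operatorname{Av}(B)$ is the set of permutations containing no element of $B$. Monotone grid class: with columns numbered left to right and rows bottom to top, a permutation $\pi$ of length $n$ belongs to the class if there are $0=c_0\le\dots\le c_k=n$ and $0=r_0\le\dots\le r_l=n$ such that for each cell $(i,j)$ the points $(p,\pi(p))$ with $c_{i-1}<p\le c_i$, $r_{j-1}<\pi(p)\le r_j$ form an increasing sequence (possibly empty) if the cell is increasing, and there are no such points if the cell is empty. -}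

module Defs where

open import Data.Nat using (ℕ; suc; _≤_; _<_)
open import Data.Fin as F using (Fin; zero; suc; toℕ; inject₁; fromℕ; #_)
open import Data.Bool using (Bool; true; false)
open import Data.Product using (Σ; ∃; _×_; _,_; proj₁)
open import Data.List using (List; []; _∷_)
open import Data.List.Membership.Propositional using (_∈_)
open import Data.Vec using (Vec; []; _∷_; lookup)
open import Function using (Injective; _⇔_)
open import Relation.Binary.PropositionalEquality using (_≡_)
open import Relation.Nullary using (¬_)

-- A permutation of length n: an injective (hence bijective) map Fin n → Fin n.
-- Position p (0-based) has value π p (0-based); the paper's point (p+1, π(p)+1).
Perm : ℕ → Set
Perm n = Σ (Fin n → Fin n) (Injective _≡_ _≡_)

Pattern : Set
Pattern = Σ ℕ λ k → (Fin k → Fin k)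

Contains : ∀ {n} → (Fin n → Fin n) → ∀ {k} → (Fin k → Fin k) → Set
Contains {n} π {k} σ =
  Σ (Fin k → Fin n) λ e →
    (∀ i j → i F.< j → e i F.< e j) ×
    (∀ i j → (σ i F.< σ j) ⇔ (π (e i) F.< π (e j)))

Av : List Pattern → ∀ {n} → Perm n → Set
Av B π = ∀ {σ} → σ ∈ B → ¬ Contains (proj₁ π) (Data.Product.proj₂ σ)

Boundaries : ℕ → ℕ → Set
Boundaries k n = Σ (Fin (suc k) → ℕ) λ c →
  (c zero ≡ 0) × (c (fromℕ k) ≡ n) × (∀ (i : Fin k) → c (inject₁ i) ≤ c (suc i))

-- 0-based index x lies in the i-th interval (c_{i} < x+1 ≤ c_{i+1}, 0-based i)
InInterval : ∀ {k} → (Fin (suc k) → ℕ) → Fin k → ℕ → Set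
InInterval c i x = (c (inject₁ i) ≤ x) × (x < c (suc i))

-- A monotone grid class with k columns and l rows: M col row = true means an
-- increasing cell, false means an empty cell (no other cell types needed).
InMonotoneGrid : ∀ {k l} → (Fin k → Fin l → Bool) → ∀ {n} → Perm n → Set
InMonotoneGrid {k} {l} M {n} π =
  Σ (Boundaries k n) λ cb → Σ (Boundaries l n) λ rb →
    let c = proj₁ cb ; r = proj₁ rb ; f = proj₁ π in
    ∀ (i : Fin k) (j : Fin l) →
      (M i j ≡ false →
        ∀ (p : Fin n) → InInterval c i (toℕ p) → InInterval r j (toℕ (f p)) → Data.Empty.⊥)
      ×
      (M i j ≡ true →
        ∀ (p q : Fin n) →
          InInterval c i (toℕ p) → InInterval r j (toℕ (f p)) →
          InInterval c i (toℕ q) → InInterval r j (toℕ (f q)) →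
          p F.< q → f p F.< f q)
  where import Data.Empty

-- The grid class B: 3 columns, 3 rows, increasing cells (column,row) =
-- (1,1),(1,2),(2,1),(3,3) (1-based); i.e. 0-based (0,0),(0,1),(1,0),(2,2).
gridB : Fin 3 → Fin 3 → Bool
gridB zero zero = true
gridB zero (suc zero) = true
gridB (suc zero) zero = true
gridB (suc (suc zero)) (suc (suc zero)) = true
gridB _ _ = false

-- pattern from one-line notation (0-based values)
pat : ∀ {k} → Vec (Fin k) k → Pattern
pat {k} v = k , lookup v

basisB : List Pattern
basisB =
    pat (# 1 ∷ # 0 ∷ # 3 ∷ # 2 ∷ [])
  ∷ pat (# 3 ∷ # 2 ∷ # 1 ∷ # 0 ∷ [])
  ∷ pat (# 2 ∷ # 4 ∷ # 0 ∷ # 3 ∷ # 1 ∷ [])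
  ∷ pat (# 2 ∷ # 4 ∷ # 1 ∷ # 0 ∷ # 3 ∷ [])
  ∷ pat (# 2 ∷ # 4 ∷ # 1 ∷ # 3 ∷ # 0 ∷ [])
  ∷ pat (# 3 ∷ # 2 ∷ # 0 ∷ # 4 ∷ # 1 ∷ [])
  ∷ pat (# 4 ∷ # 2 ∷ # 0 ∷ # 3 ∷ # 1 ∷ [])
  ∷ []

-- A gridded permutation is a direct sum of a permutation drawn in the L-shaped cells (1,1),
-- (1,2), (2,1) and an increasing run in cell (3,3).
--
-- Gridded permutations avoid the basis: two points, left to right, can form an inversion only
-- from cell (1,2) to (1,1) or (2,1), or from (1,1) to (2,1), and a non-inversion only towards a
-- cell weakly above and to the right.  For each basis pattern a few of these constraints on the
-- cells of its entries are already unsatisfiable.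
--
-- Avoiders are gridded (positions and values counted from 0): let s be least such that π fixes
-- every position from s on, c least such that π increases from position c on, and r the least
-- value that is the larger entry of an inversion among the first c positions (r = s if there is
-- none).  Columns [0,c), [c,s), [s,n) and rows [0,r), [r,s), [s,n) grid π.  The part of column 1
-- below r increases by the choice of r; that column 2 lies below r and that the part of column 1
-- above r increases are shown by case analyses in which every case exhibits a basis pattern.

module Submission where

open import Defs
open import Data.Nat using (ℕ; zero; suc; _≤_; _<_; z≤n; s≤s)
open import Data.Nat.Properties
open import Data.Fin as F using (Fin; zero; suc; toℕ; fromℕ<; inject₁; fromℕ; #_)
open import Data.Fin.Properties using (toℕ-injective; toℕ<n; toℕ-fromℕ<; fromℕ<-toℕ; toℕ-inject₁; injective⇒existsPivot)
open import Data.Vec as Vec using (Vec; []; _∷_; lookup; tabulate; _∷ʳ_)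
open import Data.Vec.Properties using (lookup∘tabulate; lookup-map)
open import Data.Vec.Relation.Unary.Linked using (Linked; []; [-]; _∷_)
open import Data.List.Relation.Unary.Any using (here; there)
open import Data.Product using (Σ; ∃; _×_; _,_; proj₁; proj₂)
open import Data.Sum using (_⊎_; inj₁; inj₂; [_,_]′)
open import Data.Empty using (⊥; ⊥-elim)
open import Data.Bool using (true; false)
open import Function using (id; _∘_; _⇔_; mk⇔; Equivalence)
open import Relation.Binary.PropositionalEquality using (_≡_; _≢_; ≢-sym; refl; sym; trans; cong; subst; subst₂)
open import Relation.Binary.Definitions using (tri<; tri≈; tri>)
open import Relation.Nullary using (¬_; yes; no)
open import Relation.Nullary.Decidable using (True; toWitness; _×-dec_)
open import Relation.Unary using (Pred; Decidable)

Ascending : ∀ {k} → Vec ℕ k → Set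
Ascending = Linked _<_

lookup-ascending : ∀ {k} {xs : Vec ℕ k} → Ascending xs → ∀ {i j} → i F.< j → lookup xs i < lookup xs j
lookup-ascending {xs = _ ∷ _ ∷ _} (x<y ∷ _)   {zero}  {suc zero}    _         = x<y
lookup-ascending {xs = _ ∷ _ ∷ _} (x<y ∷ asc) {zero}  {suc (suc j)} _         = <-trans x<y (lookup-ascending asc {zero} {suc j} (s≤s z≤n))
lookup-ascending {xs = _ ∷ _ ∷ _} (_ ∷ asc)   {suc i} {suc j}       (s≤s i<j) = lookup-ascending asc i<j

ascending-∷ʳ⁻ : ∀ {k} {xs : Vec ℕ k} {b} → Ascending (xs ∷ʳ b) → Ascending xs × (∀ i → lookup xs i < b)
ascending-∷ʳ⁻ {xs = []}         _           = [] , λ ()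
ascending-∷ʳ⁻ {xs = x ∷ []}     (x<b ∷ [-]) = [-] , λ { zero → x<b }
ascending-∷ʳ⁻ {xs = x ∷ y ∷ ys} (x<y ∷ asc) with ascending-∷ʳ⁻ asc
... | asc′ , below = x<y ∷ asc′ , λ { zero → <-trans x<y (below zero) ; (suc i) → below i }

module _ {p} {P : Pred ℕ p} (P? : Decidable P) where

  leastSuffix : ∀ m → (∀ x → m ≤ x → P x) →
    ∃ λ s → s ≤ m × (∀ x → s ≤ x → P x) × (∀ {t} → suc t ≡ s → ¬ P t)
  leastSuffix zero    all = zero , z≤n , all , λ ()
  leastSuffix (suc m) all with P? m
  ... | no ¬Pm = suc m , ≤-refl , all , λ { refl → ¬Pm }
  ... | yes Pm with leastSuffix m all′
    where
    all′ : ∀ x → m ≤ x → P x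
    all′ x m≤x with m≤n⇒m<n∨m≡n m≤x
    ... | inj₁ m<x  = all x m<x
    ... | inj₂ refl = Pm
  ...   | s , s≤m , suffix , least = s , m≤n⇒m≤1+n s≤m , suffix , least

  firstUpTo : ∀ m → ∃ λ r → r ≤ m × (∀ {x} → x < r → ¬ P x) × (r ≡ m ⊎ P r)
  firstUpTo zero = zero , z≤n , (λ ()) , inj₁ refl
  firstUpTo (suc m) with firstUpTo m
  ... | r , r≤m , before , inj₂ Pr = r , m≤n⇒m≤1+n r≤m , before , inj₂ Pr
  ... | r , _   , before , inj₁ refl with P? r
  ...   | yes Pr = r , n≤1+n r , before , inj₂ Pr
  ...   | no ¬Pr = suc r , ≤-refl , before′ , inj₁ refl
    where
    before′ : ∀ {x} → x < suc r → ¬ P x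
    before′ x<1+r with m≤n⇒m<n∨m≡n (≤-pred x<1+r)
    ... | inj₁ x<r  = before x<r
    ... | inj₂ refl = ¬Pr

≢⇒<⊎> : ∀ {x y} → x ≢ y → x < y ⊎ y < x
≢⇒<⊎> {x} {y} x≢y with <-cmp x y
... | tri< x<y _ _ = inj₁ x<y
... | tri≈ _ x≡y _ = ⊥-elim (x≢y x≡y)
... | tri> _ _ y<x = inj₂ y<x

predecessor : ∀ {x c} → x < c → ∃ λ d → x ≤ d × suc d ≡ c
predecessor (s≤s x≤d) = _ , x≤d , refl

stepwise⇒increasing : ∀ {g : ℕ → ℕ} {c} → (∀ x → c ≤ x → g x < g (suc x)) →
  ∀ {p q} → c ≤ p → p < q → g p < g q
stepwise⇒increasing step {p} {suc q} c≤p (s≤s p≤q) with m≤n⇒m<n∨m≡n p≤q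
... | inj₁ p<q  = <-trans (stepwise⇒increasing step c≤p p<q) (step q (≤-trans c≤p p≤q))
... | inj₂ refl = step p c≤p

stepwise⇒monotone : ∀ {k} (c : Fin (suc k) → ℕ) → (∀ i → c (inject₁ i) ≤ c (suc i)) →
  ∀ {i j} → i F.≤ j → c i ≤ c j
stepwise⇒monotone c step {zero}  {zero}  _         = ≤-refl
stepwise⇒monotone {suc k} c step {zero}  {suc j} _ =
  ≤-trans (step zero) (stepwise⇒monotone (c ∘ suc) (step ∘ suc) {zero} {j} z≤n)
stepwise⇒monotone {suc k} c step {suc i} {suc j} (s≤s i≤j) = stepwise⇒monotone (c ∘ suc) (step ∘ suc) i≤j

intervalOf : ∀ {k} (c : Fin (suc k) → ℕ) {x} → c zero ≤ x → x < c (fromℕ k) → ∃ λ i → InInterval c i x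
intervalOf {zero}  c     lo hi = ⊥-elim (<⇒≱ hi lo)
intervalOf {suc k} c {x} lo hi with x <? c (suc zero)
... | yes x<c₁ = zero , lo , x<c₁
... | no  x≮c₁ with intervalOf (c ∘ suc) (≮⇒≥ x≮c₁) hi
...   | i , x∈i = suc i , x∈i

interval-mono : ∀ {k} (c : Fin (suc k) → ℕ) → (∀ i → c (inject₁ i) ≤ c (suc i)) →
  ∀ {i j x y} → InInterval c i x → InInterval c j y → x ≤ y → i F.≤ j
interval-mono c step {i} {j} {x} {y} (cᵢ≤x , _) (_ , y<cⱼ₊₁) x≤y with toℕ i ≤? toℕ j
... | yes i≤j = i≤j
... | no  i≰j = ⊥-elim (<⇒≱ y<x x≤y)
  where
  j+1≤i : suc j F.≤ inject₁ i
  j+1≤i = subst (suc (toℕ j) ≤_) (sym (toℕ-inject₁ i)) (≰⇒> i≰j)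
  y<x : y < x
  y<x = <-≤-trans y<cⱼ₊₁ (≤-trans (stepwise⇒monotone c step j+1≤i) cᵢ≤x)

threeIntervals : ∀ {n a b} → a ≤ b → b ≤ n → Boundaries 3 n
threeIntervals {n} {a} {b} a≤b b≤n = bound , refl , refl , step
  where
  bound : Fin 4 → ℕ
  bound zero                   = 0
  bound (suc zero)             = a
  bound (suc (suc zero))       = b
  bound (suc (suc (suc zero))) = n
  step : ∀ i → bound (inject₁ i) ≤ bound (suc i)
  step zero             = z≤n
  step (suc zero)       = a≤b
  step (suc (suc zero)) = b≤n

module _ {n} (π : Perm n) (columns rows : Fin 4 → ℕ) where

  EmptyCell : Fin 3 → Fin 3 → Set
  EmptyCell i j = ∀ p → InInterval columns i (toℕ p) → InInterval rows j (toℕ (proj₁ π p)) → ⊥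

  IncreasingCell : Fin 3 → Fin 3 → Set
  IncreasingCell i j = ∀ p q → InInterval columns i (toℕ p) → InInterval rows j (toℕ (proj₁ π p)) →
    InInterval columns i (toℕ q) → InInterval rows j (toℕ (proj₁ π q)) → p F.< q → proj₁ π p F.< proj₁ π q

-- π followed by the identity from n on, so that positions and values can be plain naturals.
extend : ∀ {n} → (Fin n → Fin n) → ℕ → ℕ
extend {n} π p with p <? n
... | yes p<n = toℕ (π (fromℕ< p<n))
... | no  _   = p

module _ {n} (π : Fin n → Fin n) where

  extend-toℕ : ∀ i → extend π (toℕ i) ≡ toℕ (π i)
  extend-toℕ i with toℕ i <? n
  ... | yes i<n = cong (toℕ ∘ π) (fromℕ<-toℕ i i<n)
  ... | no  i≮n = ⊥-elim (i≮n (toℕ<n i))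

  extend-≥ : ∀ {p} → n ≤ p → extend π p ≡ p
  extend-≥ {p} n≤p with p <? n
  ... | yes p<n = ⊥-elim (<⇒≱ p<n n≤p)
  ... | no  _   = refl

  extend-injective : (∀ {i j} → π i ≡ π j → i ≡ j) → ∀ {p q} → extend π p ≡ extend π q → p ≡ q
  extend-injective inj {p} {q} eq with p <? n | q <? n
  ... | yes p<n | yes q<n = trans (sym (toℕ-fromℕ< p<n)) (trans (cong toℕ (inj (toℕ-injective eq))) (toℕ-fromℕ< q<n))
  ... | yes p<n | no  q≮n = ⊥-elim (<⇒≱ (subst (_< n) eq (toℕ<n _)) (≮⇒≥ q≮n))
  ... | no  p≮n | yes q<n = ⊥-elim (<⇒≱ (subst (_< n) (sym eq) (toℕ<n _)) (≮⇒≥ p≮n))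
  ... | no  _   | no  _   = eq

module Values {n} (π : Perm n) where

  f : ℕ → ℕ
  f = extend (proj₁ π)

  f-injective : ∀ {p q} → f p ≡ f q → p ≡ q
  f-injective = extend-injective (proj₁ π) (proj₂ π)

  f-≥ : ∀ {p} → n ≤ p → f p ≡ p
  f-≥ = extend-≥ (proj₁ π)

  pivot : ∀ {v} → v < n → ∃ λ t → t ≤ v × v ≤ f t
  pivot {v} v<n with injective⇒existsPivot (proj₂ π) (fromℕ< v<n)
  ... | t , t≤v , v≤πt = toℕ t , subst (toℕ t ≤_) (toℕ-fromℕ< v<n) t≤v ,
                         subst₂ _≤_ (toℕ-fromℕ< v<n) (sym (extend-toℕ (proj₁ π) t)) v≤πt

  apart : ∀ {x y} → f x < f y → x ≢ y
  apart fx<fy refl = <-irrefl refl fx<fy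

  compare-values : ∀ {x y} → x ≢ y → f x < f y ⊎ f y < f x
  compare-values x≢y = ≢⇒<⊎> (x≢y ∘ f-injective)

  compare-by-values : ∀ {x y} → f x < f y → x < y ⊎ y < x
  compare-by-values = ≢⇒<⊎> ∘ apart

  f-toℕ-< : ∀ {p v} → toℕ (proj₁ π p) < v → f (toℕ p) < v
  f-toℕ-< {p} = subst (_< _) (sym (extend-toℕ (proj₁ π) p))

  f-toℕ-≥ : ∀ {p v} → v ≤ toℕ (proj₁ π p) → v ≤ f (toℕ p)
  f-toℕ-≥ {p} = subst (_ ≤_) (sym (extend-toℕ (proj₁ π) p))

  π-< : ∀ {p q} → f (toℕ p) < f (toℕ q) → proj₁ π p F.< proj₁ π q
  π-< {p} {q} = subst₂ _<_ (extend-toℕ (proj₁ π) p) (extend-toℕ (proj₁ π) q)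

  -- byValue lists the positions of an occurrence by increasing value; the first chain lists
  -- them from left to right, closed by the bound n.
  occurrence : ∀ {k} (σ : Fin k → Fin k) (byValue : Vec ℕ k) →
    Ascending (tabulate (lookup byValue ∘ σ) ∷ʳ n) → Ascending (Vec.map f byValue) → Contains (proj₁ π) σ
  occurrence {k} σ v positions values = e , e-mono , e-iso
    where
    asc : Ascending (tabulate (lookup v ∘ σ))
    asc = proj₁ (ascending-∷ʳ⁻ positions)

    below : ∀ i → lookup (tabulate (lookup v ∘ σ)) i < n
    below = proj₂ (ascending-∷ʳ⁻ positions)

    e : Fin k → Fin n
    e i = fromℕ< (below i)

    toℕ-e : ∀ i → toℕ (e i) ≡ lookup (tabulate (lookup v ∘ σ)) i
    toℕ-e i = toℕ-fromℕ< (below i)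

    value-e : ∀ i → toℕ (proj₁ π (e i)) ≡ f (lookup v (σ i))
    value-e i = trans (sym (extend-toℕ (proj₁ π) (e i))) (cong f (trans (toℕ-e i) (lookup∘tabulate _ i)))

    rank-mono : ∀ {a b} → a F.< b → f (lookup v a) < f (lookup v b)
    rank-mono {a} {b} a<b = subst₂ _<_ (lookup-map a f v) (lookup-map b f v) (lookup-ascending values a<b)

    e-mono : ∀ i j → i F.< j → e i F.< e j
    e-mono i j i<j = subst₂ _<_ (sym (toℕ-e i)) (sym (toℕ-e j)) (lookup-ascending asc i<j)

    forward : ∀ {i j} → σ i F.< σ j → proj₁ π (e i) F.< proj₁ π (e j)
    forward {i} {j} σi<σj = subst₂ _<_ (sym (value-e i)) (sym (value-e j)) (rank-mono σi<σj)

    backward : ∀ {i j} → proj₁ π (e i) F.< proj₁ π (e j) → σ i F.< σ j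
    backward {i} {j} πi<πj with <-cmp (toℕ (σ i)) (toℕ (σ j))
    ... | tri< σi<σj _ _ = σi<σj
    ... | tri≈ _ σi≡σj _ = ⊥-elim (<-irrefl same πi<πj)
      where
      same : toℕ (proj₁ π (e i)) ≡ toℕ (proj₁ π (e j))
      same = trans (value-e i) (trans (cong (f ∘ lookup v) (toℕ-injective σi≡σj)) (sym (value-e j)))
    ... | tri> _ _ σj<σi = ⊥-elim (<-asym πi<πj (forward σj<σi))

    e-iso : ∀ i j → (σ i F.< σ j) ⇔ (proj₁ π (e i) F.< proj₁ π (e j))
    e-iso i j = mk⇔ forward backward

-- Avoiders are gridded

module Avoider {n} (π : Perm n) (av : Av basisB π) where
  open Values π public

  no-2143 : ∀ {p₀ p₁ p₂ p₃} → Ascending (p₀ ∷ p₁ ∷ p₂ ∷ p₃ ∷ n ∷ []) →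
    Ascending (f p₁ ∷ f p₀ ∷ f p₃ ∷ f p₂ ∷ []) → ⊥
  no-2143 {p₀} {p₁} {p₂} {p₃} pos val = av (here refl) (occurrence _ (p₁ ∷ p₀ ∷ p₃ ∷ p₂ ∷ []) pos val)

  no-4321 : ∀ {p₀ p₁ p₂ p₃} → Ascending (p₀ ∷ p₁ ∷ p₂ ∷ p₃ ∷ n ∷ []) →
    Ascending (f p₃ ∷ f p₂ ∷ f p₁ ∷ f p₀ ∷ []) → ⊥
  no-4321 {p₀} {p₁} {p₂} {p₃} pos val = av (there (here refl)) (occurrence _ (p₃ ∷ p₂ ∷ p₁ ∷ p₀ ∷ []) pos val)

  no-35142 : ∀ {p₀ p₁ p₂ p₃ p₄} → Ascending (p₀ ∷ p₁ ∷ p₂ ∷ p₃ ∷ p₄ ∷ n ∷ []) →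
    Ascending (f p₂ ∷ f p₄ ∷ f p₀ ∷ f p₃ ∷ f p₁ ∷ []) → ⊥
  no-35142 {p₀} {p₁} {p₂} {p₃} {p₄} pos val =
    av (there (there (here refl))) (occurrence _ (p₂ ∷ p₄ ∷ p₀ ∷ p₃ ∷ p₁ ∷ []) pos val)

  no-35214 : ∀ {p₀ p₁ p₂ p₃ p₄} → Ascending (p₀ ∷ p₁ ∷ p₂ ∷ p₃ ∷ p₄ ∷ n ∷ []) →
    Ascending (f p₃ ∷ f p₂ ∷ f p₀ ∷ f p₄ ∷ f p₁ ∷ []) → ⊥
  no-35214 {p₀} {p₁} {p₂} {p₃} {p₄} pos val =
    av (there (there (there (here refl)))) (occurrence _ (p₃ ∷ p₂ ∷ p₀ ∷ p₄ ∷ p₁ ∷ []) pos val)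

  no-35241 : ∀ {p₀ p₁ p₂ p₃ p₄} → Ascending (p₀ ∷ p₁ ∷ p₂ ∷ p₃ ∷ p₄ ∷ n ∷ []) →
    Ascending (f p₄ ∷ f p₂ ∷ f p₀ ∷ f p₃ ∷ f p₁ ∷ []) → ⊥
  no-35241 {p₀} {p₁} {p₂} {p₃} {p₄} pos val =
    av (there (there (there (there (here refl))))) (occurrence _ (p₄ ∷ p₂ ∷ p₀ ∷ p₃ ∷ p₁ ∷ []) pos val)

  no-43152 : ∀ {p₀ p₁ p₂ p₃ p₄} → Ascending (p₀ ∷ p₁ ∷ p₂ ∷ p₃ ∷ p₄ ∷ n ∷ []) →
    Ascending (f p₂ ∷ f p₄ ∷ f p₁ ∷ f p₀ ∷ f p₃ ∷ []) → ⊥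
  no-43152 {p₀} {p₁} {p₂} {p₃} {p₄} pos val =
    av (there (there (there (there (there (here refl)))))) (occurrence _ (p₂ ∷ p₄ ∷ p₁ ∷ p₀ ∷ p₃ ∷ []) pos val)

  no-53142 : ∀ {p₀ p₁ p₂ p₃ p₄} → Ascending (p₀ ∷ p₁ ∷ p₂ ∷ p₃ ∷ p₄ ∷ n ∷ []) →
    Ascending (f p₂ ∷ f p₄ ∷ f p₁ ∷ f p₃ ∷ f p₀ ∷ []) → ⊥
  no-53142 {p₀} {p₁} {p₂} {p₃} {p₄} pos val =
    av (there (there (there (there (there (there (here refl))))))) (occurrence _ (p₂ ∷ p₄ ∷ p₁ ∷ p₃ ∷ p₀ ∷ []) pos val)

module Construction {n} (π : Perm n) (av : Av basisB π) where
  open Avoider π av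

  module Suffix (s : ℕ) (s≤n : s ≤ n) (fixed : ∀ p → s ≤ p → f p ≡ p) (moved : ∀ {t} → suc t ≡ s → f t ≢ t) where

    below-s : ∀ {p} → p < s → f p < s
    below-s {p} p<s with f p <? s
    ... | yes fp<s = fp<s
    ... | no  fp≮s = ⊥-elim (<⇒≱ p<s (subst (s ≤_) p≡fp (≮⇒≥ fp≮s)))
      where
      p≡fp : f p ≡ p
      p≡fp = f-injective (fixed (f p) (≮⇒≥ fp≮s))

    last-moved-down : ∀ {L} → suc L ≡ s → f L < L
    last-moved-down refl = ≤∧≢⇒< (≤-pred (below-s ≤-refl)) (moved refl)

    rising-after-s : ∀ x → s ≤ x → f x < f (suc x)
    rising-after-s x s≤x = subst₂ _<_ (sym (fixed x s≤x)) (sym (fixed (suc x) (m≤n⇒m≤1+n s≤x))) ≤-refl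

    module Run (c : ℕ) (c≤s : c ≤ s) (rising : ∀ x → c ≤ x → f x < f (suc x))
               (c-least : ∀ {d} → suc d ≡ c → ¬ f d < f (suc d)) where

      increasing-from-c : ∀ {p q} → c ≤ p → p < q → f p < f q
      increasing-from-c = stepwise⇒increasing rising

      descent-into-c : ∀ {d} → suc d ≡ c → f c < f d
      descent-into-c {d} refl with compare-values {d} {c} (<⇒≢ ≤-refl)
      ... | inj₁ fd<fc = ⊥-elim (c-least refl fd<fc)
      ... | inj₂ fc<fd = fc<fd

      c<s : ∀ {x} → x < c → c < s
      c<s x<c with predecessor x<c
      ... | d , _ , refl = ≤∧≢⇒< c≤s c≢s
        where
        c≢s : c ≢ s
        c≢s refl = <-asym (below-s ≤-refl) (subst (_< f d) (fixed c ≤-refl) (descent-into-c refl))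

      increasing-from-c-≤ : ∀ {p q} → c ≤ p → p ≤ q → f p ≤ f q
      increasing-from-c-≤ c≤p p≤q with m≤n⇒m<n∨m≡n p≤q
      ... | inj₁ p<q  = <⇒≤ (increasing-from-c c≤p p<q)
      ... | inj₂ refl = ≤-refl

      no-4321-or-35214 : ∀ {a x t L} → a < x → x < c → t < x → c < L → L < n →
        f c < f x → f x < f a → f a < f L → f L < f t → ⊥
      no-4321-or-35214 {a} {x} {t} {L} a<x x<c t<x c<L L<n fc<fx fx<fa fa<fL fL<ft
        with compare-by-values (<-trans fa<fL fL<ft)
      ... | inj₁ a<t = no-35214 (a<t ∷ t<x ∷ x<c ∷ c<L ∷ L<n ∷ [-]) (fc<fx ∷ fx<fa ∷ fa<fL ∷ fL<ft ∷ [-])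
      ... | inj₂ t<a = no-4321 (t<a ∷ a<x ∷ x<c ∷ <-trans c<L L<n ∷ [-]) (fc<fx ∷ fx<fa ∷ <-trans fa<fL fL<ft ∷ [-])

      no-rise-into-c : ∀ {a b d t L} → suc d ≡ c → f c < f d → a < b → b < d → t < b → c < L → L < n →
        f b < f c → f b < f a → f a < f L → f L < f t → f d < f L → ⊥
      no-rise-into-c {a} {b} {d} {t} {L} refl fc<fd a<b b<d t<b c<L L<n fb<fc fb<fa fa<fL fL<ft fd<fL
        with compare-values (<⇒≢ (<-trans a<b b<d))
      ... | inj₂ fd<fa = no-4321-or-35214 (<-trans a<b b<d) ≤-refl (<-trans t<b b<d) c<L L<n fc<fd fd<fa fa<fL fL<ft
      ... | inj₁ fa<fd with compare-values (<⇒≢ (<-trans a<b (<-trans b<d ≤-refl)))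
      ...   | inj₁ fa<fc = no-2143 (a<b ∷ b<d ∷ ≤-refl ∷ <-trans c<L L<n ∷ [-]) (fb<fa ∷ fa<fc ∷ fc<fd ∷ [-])
      ...   | inj₂ fc<fa with compare-by-values (<-trans fa<fL fL<ft)
      ...     | inj₁ a<t = no-35142 (a<t ∷ t<b ∷ b<d ∷ ≤-refl ∷ <-trans c<L L<n ∷ [-])
                                    (fb<fc ∷ fc<fa ∷ fa<fd ∷ <-trans fd<fL fL<ft ∷ [-])
      ...     | inj₂ t<a = no-53142 (t<a ∷ a<b ∷ b<d ∷ ≤-refl ∷ <-trans c<L L<n ∷ [-])
                                    (fb<fc ∷ fc<fa ∷ fa<fd ∷ <-trans fd<fL fL<ft ∷ [-])

      no-descent-under-peak : ∀ {a b d t L} → suc d ≡ c → a < b → b ≤ d → t < b → c < L → L < n →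
        f b < f a → f a < f L → f L < f t → f d < f L → ⊥
      no-descent-under-peak {a} {b} {d} {t} {L} refl a<b b≤d t<b c<L L<n fb<fa fa<fL fL<ft fd<fL
        with compare-values (<⇒≢ (s≤s b≤d))
      ... | inj₂ fc<fb = no-4321-or-35214 a<b (s≤s b≤d) t<b c<L L<n fc<fb fb<fa fa<fL fL<ft
      ... | inj₁ fb<fc = no-rise-into-c refl fc<fd a<b (≤∧≢⇒< b≤d (apart (<-trans fb<fc fc<fd))) t<b c<L L<n
                           fb<fc fb<fa fa<fL fL<ft fd<fL
        where
        fc<fd : f c < f d
        fc<fd = descent-into-c refl

      no-inversion-under-peak : ∀ {a b t L} → a < b → b < c → c ≤ L → L < n → t < c →
        f b < f a → f a < f L → f L < f t → ⊥
      no-inversion-under-peak {a} {b} {t} {L} a<b b<c c≤L L<n t<c fb<fa fa<fL fL<ft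
        with compare-by-values (<-trans fb<fa (<-trans fa<fL fL<ft))
      ... | inj₁ b<t = no-2143 (a<b ∷ b<t ∷ <-≤-trans t<c c≤L ∷ L<n ∷ [-]) (fb<fa ∷ fa<fL ∷ fL<ft ∷ [-])
      ... | inj₂ t<b with predecessor b<c
      ...   | d , b≤d , 1+d≡c with compare-values (<⇒≢ (<-≤-trans (≤-reflexive 1+d≡c) c≤L))
      ...     | inj₁ fd<fL = no-descent-under-peak 1+d≡c a<b b≤d t<b c<L L<n fb<fa fa<fL fL<ft fd<fL
        where
        c<L : c < L
        c<L = ≤∧≢⇒< c≤L (apart (<-trans (descent-into-c 1+d≡c) fd<fL))
      ...     | inj₂ fL<fd = no-2143 (a<b ∷ b<d ∷ <-≤-trans (≤-reflexive 1+d≡c) c≤L ∷ L<n ∷ [-]) 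
                                     (fb<fa ∷ fa<fL ∷ fL<fd ∷ [-])
        where
        b<d : b < d
        b<d = ≤∧≢⇒< b≤d (apart (<-trans fb<fa (<-trans fa<fL fL<fd)))

      -- Position s - 1 is moved down, so the value s - 1 is taken by a point t of column 1, which
      -- lies above all of column 2.
      no-column₂-point-above-inversion : ∀ {a b y} → a < b → b < c → f b < f a → c ≤ y → y < s → f a ≤ f y → ⊥
      no-column₂-point-above-inversion {a} {b} {y} a<b b<c fb<fa c≤y y<s fa≤fy with predecessor y<s
      ... | L , y≤L , 1+L≡s with pivot (≤-trans (≤-reflexive 1+L≡s) s≤n)
      ...   | t , t≤L , L≤ft = no-inversion-under-peak a<b b<c c≤L L<n t<c fb<fa fa<fL fL<ft
        where
        L<n : L < n
        L<n = ≤-trans (≤-reflexive 1+L≡s) s≤n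
        c≤L : c ≤ L
        c≤L = ≤-trans c≤y y≤L
        fa<fL : f a < f L
        fa<fL = ≤∧≢⇒< (≤-trans fa≤fy (increasing-from-c-≤ c≤y y≤L))
                      (<⇒≢ (<-≤-trans (<-trans a<b b<c) c≤L) ∘ f-injective)
        ft≡L : f t ≡ L
        ft≡L = ≤-antisym (≤-pred (≤-trans (below-s (≤-<-trans t≤L (≤-reflexive 1+L≡s))) (≤-reflexive (sym 1+L≡s)))) L≤ft
        fL<ft : f L < f t
        fL<ft = subst (f L <_) (sym ft≡L) (last-moved-down 1+L≡s)
        t<c : t < c
        t<c with t <? c
        ... | yes t<c = t<c
        ... | no  t≮c = ⊥-elim (<-asym fL<ft (increasing-from-c (≮⇒≥ t≮c) (≤∧≢⇒< t≤L (≢-sym (apart fL<ft)))))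

      no-stacked-inversions-q<b : ∀ {a b d p q} → suc d ≡ c → a < b → b ≤ d → p < q → q < b →
        f b < f a → f c < f a → f a ≤ f q → f q < f p → ⊥
      no-stacked-inversions-q<b {a} {b} {d} {p} {q} refl a<b b≤d p<q q<b fb<fa fc<fa fa≤fq fq<fp
        with c<n ← <-≤-trans (c<s ≤-refl) s≤n | fc<fd ← descent-into-c refl | compare-values (<⇒≢ (s≤s b≤d))
      ... | inj₂ fc<fb = no-4321 (p<q ∷ q<b ∷ s≤s b≤d ∷ c<n ∷ [-]) (fc<fb ∷ <-≤-trans fb<fa fa≤fq ∷ fq<fp ∷ [-])
      ... | inj₁ fb<fc with b<d ← ≤∧≢⇒< b≤d (apart (<-trans fb<fc fc<fd)) | compare-values (<⇒≢ (<-trans a<b b<d))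
      ...   | inj₂ fd<fa = no-4321 (p<q ∷ <-trans q<b b<d ∷ ≤-refl ∷ c<n ∷ [-]) 
                                   (fc<fd ∷ <-≤-trans fd<fa fa≤fq ∷ fq<fp ∷ [-])
      ...   | inj₁ fa<fd with compare-by-values (≤-<-trans fa≤fq fq<fp) | compare-values (<⇒≢ (<-trans (<-trans p<q q<b) b<d))
      ...     | inj₂ p<a | inj₂ fd<fp = no-53142 (p<a ∷ a<b ∷ b<d ∷ ≤-refl ∷ c<n ∷ [-]) 
                                                 (fb<fc ∷ fc<fa ∷ fa<fd ∷ fd<fp ∷ [-])
      ...     | inj₂ p<a | inj₁ fp<fd = no-43152 (p<a ∷ a<b ∷ b<d ∷ ≤-refl ∷ c<n ∷ [-]) 
                                                 (fb<fc ∷ fc<fa ∷ ≤-<-trans fa≤fq fq<fp ∷ fp<fd ∷ [-])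
      ...     | inj₁ a<p | inj₂ fd<fp = no-35142 (a<p ∷ <-trans p<q q<b ∷ b<d ∷ ≤-refl ∷ c<n ∷ [-]) 
                                                 (fb<fc ∷ fc<fa ∷ fa<fd ∷ fd<fp ∷ [-])
      ...     | inj₁ _   | inj₁ fp<fd = no-43152 (p<q ∷ q<b ∷ b<d ∷ ≤-refl ∷ c<n ∷ [-]) 
                                                 (fb<fc ∷ <-≤-trans fc<fa fa≤fq ∷ fq<fp ∷ fp<fd ∷ [-])

      no-stacked-inversions-b<q : ∀ {a b p q} → a < b → b < q → p < q → q < c →
        f b < f a → f c < f a → f a ≤ f q → f q < f p → ⊥
      no-stacked-inversions-b<q {a} {b} {p} {q} a<b b<q p<q q<c fb<fa fc<fa fa≤fq fq<fp
        with c<n ← <-≤-trans (c<s q<c) s≤n | fa<fq ← ≤∧≢⇒< fa≤fq (<⇒≢ (<-trans a<b b<q) ∘ f-injective)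
           | compare-by-values (<-trans fb<fa (<-trans fa<fq fq<fp))
      ... | inj₁ b<p = no-2143 (a<b ∷ b<p ∷ p<q ∷ <-trans q<c c<n ∷ [-]) (fb<fa ∷ fa<fq ∷ fq<fp ∷ [-])
      ... | inj₂ p<b with compare-values (<⇒≢ (<-trans b<q q<c)) | compare-by-values (≤-<-trans fa≤fq fq<fp)
      ...   | inj₂ fc<fb | inj₂ p<a = no-4321 (p<a ∷ a<b ∷ <-trans b<q q<c ∷ c<n ∷ [-]) 
                                              (fc<fb ∷ fb<fa ∷ ≤-<-trans fa≤fq fq<fp ∷ [-])
      ...   | inj₂ fc<fb | inj₁ a<p = no-35241 (a<p ∷ p<b ∷ b<q ∷ q<c ∷ c<n ∷ [-]) (fc<fb ∷ fb<fa ∷ fa<fq ∷ fq<fp ∷ [-])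
      ...   | inj₁ fb<fc | inj₂ p<a = no-53142 (p<a ∷ a<b ∷ b<q ∷ q<c ∷ c<n ∷ [-]) (fb<fc ∷ fc<fa ∷ fa<fq ∷ fq<fp ∷ [-])
      ...   | inj₁ fb<fc | inj₁ a<p = no-35142 (a<p ∷ p<b ∷ b<q ∷ q<c ∷ c<n ∷ [-]) (fb<fc ∷ fc<fa ∷ fa<fq ∷ fq<fp ∷ [-])

      no-stacked-inversions : ∀ {a b p q} → a < b → b < c → f b < f a → p < q → q < c → f a ≤ f q → f q < f p → ⊥
      no-stacked-inversions {a} {b} {p} {q} a<b b<c fb<fa p<q q<c fa≤fq fq<fp
        with fc<fa ← ≰⇒> (no-column₂-point-above-inversion a<b b<c fb<fa ≤-refl (c<s b<c))
           | compare-by-values (<-≤-trans fb<fa fa≤fq)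
      ... | inj₁ b<q = no-stacked-inversions-b<q a<b b<q p<q q<c fb<fa fc<fa fa≤fq fq<fp
      ... | inj₂ q<b with predecessor b<c
      ...   | _ , b≤d , 1+d≡c = no-stacked-inversions-q<b 1+d≡c a<b b≤d p<q q<b fb<fa fc<fa fa≤fq fq<fp

      InversionTop : ℕ → Set
      InversionTop v = ∃ λ b → b < c × ∃ λ a → a < b × f b < f a × f a ≡ v

      inversionTop? : Decidable InversionTop
      inversionTop? v = anyUpTo? (λ b → anyUpTo? (λ a → (f b <? f a) ×-dec (f a ≟ v)) b) c

      module RowSplit (r : ℕ) (r≤s : r ≤ s) (below-r : ∀ {v} → v < r → ¬ InversionTop v)
                  (r-top : r ≡ s ⊎ InversionTop r) where

        lower-increasing : ∀ {x y} → x < y → y < c → f x < r → f x < f y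
        lower-increasing {x} {y} x<y y<c fx<r with compare-values (<⇒≢ x<y)
        ... | inj₁ fx<fy = fx<fy
        ... | inj₂ fy<fx = ⊥-elim (below-r fx<r (y , y<c , x , x<y , fy<fx , refl))

        inversion-at-r : r < s → InversionTop r
        inversion-at-r r<s = [ (λ r≡s → ⊥-elim (<-irrefl r≡s r<s)) , id ]′ r-top

        column₂-below-r : ∀ {y} → c ≤ y → y < s → f y < r
        column₂-below-r {y} c≤y y<s with f y <? r
        ... | yes fy<r = fy<r
        ... | no  fy≮r with inversion-at-r (≤-<-trans (≮⇒≥ fy≮r) (below-s y<s))
        ...   | b , b<c , a , a<b , fb<fa , refl = ⊥-elim (no-column₂-point-above-inversion a<b b<c fb<fa c≤y y<s (≮⇒≥ fy≮r))

        upper-increasing : ∀ {p q} → p < q → q < c → r ≤ f q → f p < f q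
        upper-increasing {p} {q} p<q q<c r≤fq with compare-values (<⇒≢ p<q)
        ... | inj₁ fp<fq = fp<fq
        ... | inj₂ fq<fp with inversion-at-r (≤-<-trans r≤fq (below-s (<-trans q<c (c<s q<c))))
        ...   | b , b<c , a , a<b , fb<fa , refl = ⊥-elim (no-stacked-inversions a<b b<c fb<fa p<q q<c r≤fq fq<fp)

        fixed-above : ∀ {p} → s ≤ p → s ≤ f p
        fixed-above {p} s≤p = subst (s ≤_) (sym (fixed p s≤p)) s≤p

        columns : Boundaries 3 n
        columns = threeIntervals c≤s s≤n

        rows : Boundaries 3 n
        rows = threeIntervals r≤s s≤n

        cells : ∀ i j → (gridB i j ≡ false → EmptyCell π (proj₁ columns) (proj₁ rows) i j)
                      × (gridB i j ≡ true → IncreasingCell π (proj₁ columns) (proj₁ rows) i j)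
        cells zero zero = (λ ()) , λ _ _ _ _ (_ , fp<r) (_ , q<c) _ p<q →
          π-< (lower-increasing p<q q<c (f-toℕ-< fp<r))
        cells zero (suc zero) = (λ ()) , λ _ _ _ _ _ (_ , q<c) (r≤fq , _) p<q →
          π-< (upper-increasing p<q q<c (f-toℕ-≥ r≤fq))
        cells zero (suc (suc zero)) = (λ _ _ (_ , p<c) (s≤fp , _) → <⇒≱ (below-s (<-≤-trans p<c c≤s)) (f-toℕ-≥ s≤fp)) , λ ()
        cells (suc zero) zero = (λ ()) , λ _ _ _ (c≤p , _) _ _ _ p<q → π-< (increasing-from-c c≤p p<q)
        cells (suc zero) (suc zero) = (λ _ _ (c≤p , p<s) (r≤fp , _) → <⇒≱ (column₂-below-r c≤p p<s) (f-toℕ-≥ r≤fp)) , λ ()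
        cells (suc zero) (suc (suc zero)) = (λ _ _ (_ , p<s) (s≤fp , _) → <⇒≱ (below-s p<s) (f-toℕ-≥ s≤fp)) , λ ()
        cells (suc (suc zero)) zero = (λ _ _ (s≤p , _) (_ , fp<r) → <⇒≱ (f-toℕ-< fp<r) (≤-trans r≤s (fixed-above s≤p))) , λ ()
        cells (suc (suc zero)) (suc zero) = (λ _ _ (s≤p , _) (_ , fp<s) → <⇒≱ (f-toℕ-< fp<s) (fixed-above s≤p)) , λ ()
        cells (suc (suc zero)) (suc (suc zero)) = (λ ()) , λ _ p q (s≤p , _) _ (s≤q , _) _ p<q →
          π-< (subst₂ _<_ (sym (fixed _ s≤p)) (sym (fixed _ s≤q)) p<q)

        gridded : InMonotoneGrid gridB π
        gridded = columns , rows , cells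

  avoider-gridded : InMonotoneGrid gridB π
  avoider-gridded
    with s , s≤n , fixed , moved ← leastSuffix (λ p → f p ≟ p) n (λ _ → f-≥)
    with c , c≤s , rising , c-least ← leastSuffix (λ x → f x <? f (suc x)) s (Suffix.rising-after-s s s≤n fixed moved)
    with r , r≤s , below-r , r-top ← firstUpTo (Suffix.Run.inversionTop? s s≤n fixed moved c c≤s rising c-least) s
    = Suffix.Run.RowSplit.gridded s s≤n fixed moved c c≤s rising c-least r r≤s below-r r-top

-- Gridded permutations are avoiders

-- The increasing cells of gridB, as (column,row) in the paper's numbering.
data Cell : Set where
  c₁₁ c₁₂ c₂₁ c₃₃ : Cell

column row : Cell → Fin 3
column c₁₁ = # 0
column c₁₂ = # 0
column c₂₁ = # 1
column c₃₃ = # 2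
row c₁₁ = # 0
row c₁₂ = # 1
row c₂₁ = # 0
row c₃₃ = # 2

cellAt : ∀ i j → gridB i j ≡ true → Σ Cell λ x → column x ≡ i × row x ≡ j
cellAt zero             zero             _ = c₁₁ , refl , refl
cellAt zero             (suc zero)       _ = c₁₂ , refl , refl
cellAt (suc zero)       zero             _ = c₂₁ , refl , refl
cellAt (suc (suc zero)) (suc (suc zero)) _ = c₃₃ , refl , refl
cellAt zero             (suc (suc zero)) ()
cellAt (suc zero)       (suc zero)       ()
cellAt (suc zero)       (suc (suc zero)) ()
cellAt (suc (suc zero)) zero             ()
cellAt (suc (suc zero)) (suc zero)       ()

-- x ↗ y (x ↘ y): a point of cell x can be followed, further right, by a higher (lower) point
-- of cell y.
data _↗_ : Cell → Cell → Set where
  c₁₁↗c₁₁ : c₁₁ ↗ c₁₁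
  c₁₁↗c₁₂ : c₁₁ ↗ c₁₂
  c₁₁↗c₂₁ : c₁₁ ↗ c₂₁
  c₁₁↗c₃₃ : c₁₁ ↗ c₃₃
  c₁₂↗c₁₂ : c₁₂ ↗ c₁₂
  c₁₂↗c₃₃ : c₁₂ ↗ c₃₃
  c₂₁↗c₂₁ : c₂₁ ↗ c₂₁
  c₂₁↗c₃₃ : c₂₁ ↗ c₃₃
  c₃₃↗c₃₃ : c₃₃ ↗ c₃₃

data _↘_ : Cell → Cell → Set where
  c₁₂↘c₁₁ : c₁₂ ↘ c₁₁
  c₁₂↘c₂₁ : c₁₂ ↘ c₂₁
  c₁₁↘c₂₁ : c₁₁ ↘ c₂₁

↗-from : ∀ {x y} → column x F.≤ column y → row x F.≤ row y → x ↗ y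
↗-from {c₁₁} {c₁₁} _ _ = c₁₁↗c₁₁
↗-from {c₁₁} {c₁₂} _ _ = c₁₁↗c₁₂
↗-from {c₁₁} {c₂₁} _ _ = c₁₁↗c₂₁
↗-from {c₁₁} {c₃₃} _ _ = c₁₁↗c₃₃
↗-from {c₁₂} {c₁₂} _ _ = c₁₂↗c₁₂
↗-from {c₁₂} {c₃₃} _ _ = c₁₂↗c₃₃
↗-from {c₂₁} {c₂₁} _ _ = c₂₁↗c₂₁
↗-from {c₂₁} {c₃₃} _ _ = c₂₁↗c₃₃
↗-from {c₃₃} {c₃₃} _ _ = c₃₃↗c₃₃
↗-from {c₁₂} {c₁₁} _ ()
↗-from {c₁₂} {c₂₁} _ ()
↗-from {c₂₁} {c₁₁} () _
↗-from {c₂₁} {c₁₂} () _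
↗-from {c₃₃} {c₁₁} () _
↗-from {c₃₃} {c₁₂} () _
↗-from {c₃₃} {c₂₁} (s≤s ()) _

↘-from : ∀ {x y} → column x F.≤ column y → row y F.≤ row x → x ≢ y → x ↘ y
↘-from {c₁₂} {c₁₁} _ _ _ = c₁₂↘c₁₁
↘-from {c₁₂} {c₂₁} _ _ _ = c₁₂↘c₂₁
↘-from {c₁₁} {c₂₁} _ _ _ = c₁₁↘c₂₁
↘-from {c₁₁} {c₁₁} _ _ x≢y = ⊥-elim (x≢y refl)
↘-from {c₁₂} {c₁₂} _ _ x≢y = ⊥-elim (x≢y refl)
↘-from {c₂₁} {c₂₁} _ _ x≢y = ⊥-elim (x≢y refl)
↘-from {c₃₃} {c₃₃} _ _ x≢y = ⊥-elim (x≢y refl)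
↘-from {c₁₁} {c₁₂} _ () _
↘-from {c₁₁} {c₃₃} _ () _
↘-from {c₁₂} {c₃₃} _ (s≤s ()) _
↘-from {c₂₁} {c₁₁} () _ _
↘-from {c₂₁} {c₁₂} () _ _
↘-from {c₂₁} {c₃₃} _ () _
↘-from {c₃₃} {c₁₁} () _ _
↘-from {c₃₃} {c₁₂} () _ _
↘-from {c₃₃} {c₂₁} (s≤s ()) _ _
ungriddable-2143 : ∀ {x₀ x₁ x₂ x₃} → x₂ ↘ x₃ → x₀ ↗ x₃ → x₀ ↘ x₁ → x₁ ↗ x₂ → ⊥
ungriddable-2143 c₁₁↘c₂₁ c₁₁↗c₂₁ c₁₁↘c₂₁ ()
ungriddable-2143 c₁₁↘c₂₁ c₂₁↗c₂₁ () _
ungriddable-2143 c₁₂↘c₁₁ c₁₁↗c₁₁ c₁₁↘c₂₁ ()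
ungriddable-2143 c₁₂↘c₂₁ c₁₁↗c₂₁ c₁₁↘c₂₁ ()
ungriddable-2143 c₁₂↘c₂₁ c₂₁↗c₂₁ () _

ungriddable-4321 : ∀ {x₀ x₁ x₂ x₃} → x₀ ↘ x₁ → x₁ ↘ x₂ → x₂ ↘ x₃ → ⊥
ungriddable-4321 c₁₁↘c₂₁ () _
ungriddable-4321 c₁₂↘c₁₁ c₁₁↘c₂₁ ()
ungriddable-4321 c₁₂↘c₂₁ () _

ungriddable-35142 : ∀ {x₀ x₁ x₂ x₃ x₄} → x₁ ↘ x₃ → x₃ ↘ x₄ → x₀ ↗ x₃ → x₀ ↘ x₂ → x₂ ↗ x₃ → ⊥
ungriddable-35142 c₁₁↘c₂₁ () _ _ _
ungriddable-35142 c₁₂↘c₁₁ c₁₁↘c₂₁ c₁₁↗c₁₁ c₁₁↘c₂₁ ()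
ungriddable-35142 c₁₂↘c₂₁ () _ _ _

ungriddable-35214 : ∀ {x₀ x₁ x₂ x₃ x₄} → x₀ ↘ x₂ → x₂ ↘ x₃ → x₀ ↗ x₄ → x₁ ↘ x₄ → ⊥
ungriddable-35214 c₁₁↘c₂₁ () _ _
ungriddable-35214 c₁₂↘c₁₁ c₁₁↘c₂₁ c₁₂↗c₁₂ ()
ungriddable-35214 c₁₂↘c₁₁ c₁₁↘c₂₁ c₁₂↗c₃₃ ()
ungriddable-35214 c₁₂↘c₂₁ () _ _

ungriddable-35241 : ∀ {x₀ x₁ x₂ x₃ x₄} → x₀ ↘ x₂ → x₂ ↘ x₄ → x₀ ↗ x₃ → x₁ ↘ x₃ → ⊥
ungriddable-35241 c₁₁↘c₂₁ () _ _
ungriddable-35241 c₁₂↘c₁₁ c₁₁↘c₂₁ c₁₂↗c₁₂ ()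
ungriddable-35241 c₁₂↘c₁₁ c₁₁↘c₂₁ c₁₂↗c₃₃ ()
ungriddable-35241 c₁₂↘c₂₁ () _ _

ungriddable-43152 : ∀ {x₀ x₁ x₂ x₃ x₄} → x₀ ↘ x₁ → x₁ ↘ x₂ → x₂ ↗ x₃ → x₃ ↘ x₄ → ⊥
ungriddable-43152 c₁₁↘c₂₁ () _ _
ungriddable-43152 c₁₂↘c₁₁ c₁₁↘c₂₁ c₂₁↗c₂₁ ()
ungriddable-43152 c₁₂↘c₁₁ c₁₁↘c₂₁ c₂₁↗c₃₃ ()
ungriddable-43152 c₁₂↘c₂₁ () _ _

ungriddable-53142 : ∀ {x₀ x₁ x₂ x₃ x₄} → x₀ ↘ x₁ → x₁ ↘ x₂ → x₂ ↗ x₃ → x₃ ↘ x₄ → ⊥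
ungriddable-53142 c₁₁↘c₂₁ () _ _
ungriddable-53142 c₁₂↘c₁₁ c₁₁↘c₂₁ c₂₁↗c₂₁ ()
ungriddable-53142 c₁₂↘c₁₁ c₁₁↘c₂₁ c₂₁↗c₃₃ ()
ungriddable-53142 c₁₂↘c₂₁ () _ _

module Gridded {n} (π : Perm n) (grid : InMonotoneGrid gridB π) where

  P : Fin n → Fin n
  P = proj₁ π

  columns rows : Fin 4 → ℕ
  columns = proj₁ (proj₁ grid)
  rows    = proj₁ (proj₁ (proj₂ grid))

  intervalOf-bounded : ∀ (b : Boundaries 3 n) (p : Fin n) → ∃ λ i → InInterval (proj₁ b) i (toℕ p)
  intervalOf-bounded (c , c₀≡0 , c₃≡n , _) p =
    intervalOf c (subst (_≤ toℕ p) (sym c₀≡0) z≤n) (subst (toℕ p <_) (sym c₃≡n) (toℕ<n p))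

  columnOf rowOf : Fin n → Fin 3
  columnOf p = proj₁ (intervalOf-bounded (proj₁ grid) p)
  rowOf    p = proj₁ (intervalOf-bounded (proj₁ (proj₂ grid)) (P p))

  in-column : ∀ p → InInterval columns (columnOf p) (toℕ p)
  in-column p = proj₂ (intervalOf-bounded (proj₁ grid) p)

  in-row : ∀ p → InInterval rows (rowOf p) (toℕ (P p))
  in-row p = proj₂ (intervalOf-bounded (proj₁ (proj₂ grid)) (P p))

  occupied : ∀ p → gridB (columnOf p) (rowOf p) ≡ true
  occupied p with gridB (columnOf p) (rowOf p) in empty
  ... | true  = refl
  ... | false = ⊥-elim (proj₁ (proj₂ (proj₂ grid) (columnOf p) (rowOf p)) empty p (in-column p) (in-row p))

  cellOf : Fin n → Cell
  cellOf p = proj₁ (cellAt _ _ (occupied p))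

  column-cellOf : ∀ p → column (cellOf p) ≡ columnOf p
  column-cellOf p = proj₁ (proj₂ (cellAt _ _ (occupied p)))

  row-cellOf : ∀ p → row (cellOf p) ≡ rowOf p
  row-cellOf p = proj₂ (proj₂ (cellAt _ _ (occupied p)))

  column-mono : ∀ {p q} → toℕ p ≤ toℕ q → columnOf p F.≤ columnOf q
  column-mono {p} {q} = interval-mono columns (proj₂ (proj₂ (proj₂ (proj₁ grid)))) (in-column p) (in-column q)

  row-mono : ∀ {p q} → toℕ (P p) ≤ toℕ (P q) → rowOf p F.≤ rowOf q
  row-mono {p} {q} = interval-mono rows (proj₂ (proj₂ (proj₂ (proj₁ (proj₂ grid))))) (in-row p) (in-row q)

  same-cell-increasing : ∀ {p q} → p F.< q → cellOf p ≡ cellOf q → P p F.< P q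
  same-cell-increasing {p} {q} p<q same =
    proj₂ (proj₂ (proj₂ grid) (columnOf p) (rowOf p)) (occupied p) p q (in-column p) (in-row p)
      (subst (λ i → InInterval columns i (toℕ q)) (sym same-column) (in-column q))
      (subst (λ j → InInterval rows j (toℕ (P q))) (sym same-row) (in-row q)) p<q
    where
    same-column : columnOf p ≡ columnOf q
    same-column = trans (sym (column-cellOf p)) (trans (cong column same) (column-cellOf q))
    same-row : rowOf p ≡ rowOf q
    same-row = trans (sym (row-cellOf p)) (trans (cong row same) (row-cellOf q))

  rise : ∀ {p q} → p F.< q → P p F.< P q → cellOf p ↗ cellOf q
  rise {p} {q} p<q Pp<Pq = ↗-from
    (subst₂ F._≤_ (sym (column-cellOf p)) (sym (column-cellOf q)) (column-mono (<⇒≤ p<q)))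
    (subst₂ F._≤_ (sym (row-cellOf p)) (sym (row-cellOf q)) (row-mono (<⇒≤ Pp<Pq)))

  fall : ∀ {p q} → p F.< q → P q F.< P p → cellOf p ↘ cellOf q
  fall {p} {q} p<q Pq<Pp = ↘-from
    (subst₂ F._≤_ (sym (column-cellOf p)) (sym (column-cellOf q)) (column-mono (<⇒≤ p<q)))
    (subst₂ F._≤_ (sym (row-cellOf q)) (sym (row-cellOf p)) (row-mono (<⇒≤ Pq<Pp)))
    (λ same → <-asym Pq<Pp (same-cell-increasing p<q same))

  rises : ∀ {k} {σ : Fin k → Fin k} (occ : Contains P σ) i j → {True (i F.<? j)} → {True (σ i F.<? σ j)} →
    cellOf (proj₁ occ i) ↗ cellOf (proj₁ occ j)
  rises (e , e-mono , e-iso) i j {i<j} {σi<σj} = rise (e-mono i j (toWitness i<j)) (Equivalence.to (e-iso i j) (toWitness σi<σj))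

  falls : ∀ {k} {σ : Fin k → Fin k} (occ : Contains P σ) i j → {True (i F.<? j)} → {True (σ j F.<? σ i)} →
    cellOf (proj₁ occ i) ↘ cellOf (proj₁ occ j)
  falls (e , e-mono , e-iso) i j {i<j} {σj<σi} = fall (e-mono i j (toWitness i<j)) (Equivalence.to (e-iso j i) (toWitness σj<σi))

  avoids : Av basisB π
  avoids (here refl) occ =
    ungriddable-2143 (falls occ (# 2) (# 3)) (rises occ (# 0) (# 3)) (falls occ (# 0) (# 1)) (rises occ (# 1) (# 2))
  avoids (there (here refl)) occ =
    ungriddable-4321 (falls occ (# 0) (# 1)) (falls occ (# 1) (# 2)) (falls occ (# 2) (# 3))
  avoids (there (there (here refl))) occ =
    ungriddable-35142 (falls occ (# 1) (# 3)) (falls occ (# 3) (# 4)) (rises occ (# 0) (# 3)) (falls occ (# 0) (# 2)) (rises occ (# 2) (# 3))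
  avoids (there (there (there (here refl)))) occ =
    ungriddable-35214 (falls occ (# 0) (# 2)) (falls occ (# 2) (# 3)) (rises occ (# 0) (# 4)) (falls occ (# 1) (# 4))
  avoids (there (there (there (there (here refl))))) occ =
    ungriddable-35241 (falls occ (# 0) (# 2)) (falls occ (# 2) (# 4)) (rises occ (# 0) (# 3)) (falls occ (# 1) (# 3))
  avoids (there (there (there (there (there (here refl)))))) occ =
    ungriddable-43152 (falls occ (# 0) (# 1)) (falls occ (# 1) (# 2)) (rises occ (# 2) (# 3)) (falls occ (# 3) (# 4))
  avoids (there (there (there (there (there (there (here refl))))))) occ =
    ungriddable-53142 (falls occ (# 0) (# 1)) (falls occ (# 1) (# 2)) (rises occ (# 2) (# 3)) (falls occ (# 3) (# 4))
  avoids (there (there (there (there (there (there (there (()))))))))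

mainTheorem3 : ∀ (n : ℕ) (π : Perm n) → InMonotoneGrid gridB π ⇔ Av basisB π
mainTheorem3 n π = mk⇔ (λ grid {σ} → Gridded.avoids π grid {σ}) (Construction.avoider-gridded π)
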